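{- For all integers $1\le k\le n$, $$\mathfrak{WB}_{n,k}(x):=\sum_{\pi\in B_n}x^{\mathrm{des}_k^B(\pi)}=\sum_{p=0}^{\lfloor (n-k+1)/2\rfloor}\gamma^B_{n,k,p}\,x^p(1+x)^{n-k+1-2p},$$ where $\gamma^B_{n,k,p}=2^{2p+k-1}\,|\Gamma^{(\ell)}_{n,k,p}|$ and $\Gamma^{(\ell)}_{n,k,p}$ is the set of permutations $\sigma\in\mathfrak{S}_n$ with exactly $p$ width-$k$ left peaks, i.e. $\mathrm{lpeak}_k(\sigma)=p$.
   Context: $B_n$ is the set of signed permutations of $[n]$: bijections $\pi$ of $\{\pm1,\dots,\pm n\}$ with $\pi(-i)=-\pi(i)$, written $\pi=(\pi(1),\dots,\pi(n))$; set $\pi(0)=0$. $\mathrm{des}_k^B(\pi)=|\{0\le i\le n-k:\pi(i)>\pi(i+k)\}|$. $\mathfrak{S}_n$ is the symmetric group on $[n]$. For $\sigma\in\mathfrak{S}_n$, with convention $\sigma(0)=0$, the set of width-$k$ left peaks is $\mathrm{Lpeak}_k(\sigma)=\{k\le i\le n-k:\sigma(i-k)<\sigma(i)>\sigma(i+k)\}$ and $\mathrm{lpeak}_k(\sigma)=|\mathrm{Lpeak}_k(\sigma)|$. -}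

module Defs where

open import Data.Nat using (ℕ; zero; suc; _+_; _*_; _∸_; _^_; _/_)
import Data.Nat as ℕ
open import Data.Integer as ℤ using (ℤ; +_; -_; ∣_∣)
open import Data.Nat.ListAction using (sum)
open import Data.List using (List; []; _∷_; map; concatMap; filter; length; upTo; zip; drop; _++_)
open import Data.Product using (_×_; _,_)
open import Relation.Nullary.Decidable using (¬?)
open import Data.List.Relation.Unary.Unique.DecPropositional ℕ._≟_ using (unique?)

words : {A : Set} → ℕ → List A → List (List A)
words zero    as = [] ∷ []
words (suc m) as = concatMap (λ a → map (a ∷_) (words m as)) as

range1 : ℕ → List ℕ
range1 n = map suc (upTo n)

Sn : ℕ → List (List ℕ)
Sn n = filter (λ w → unique? w) (words n (range1 n))

-- The hyperoctahedral group B_n: a signed permutation π is determined by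
-- (π(1),…,π(n)) ∈ {±1,…,±n}^n whose absolute values are pairwise distinct
-- (π(-i) = -π(i) then gives the bijection of {±1,…,±n}).
Bn : ℕ → List (List ℤ)
Bn n = filter (λ w → unique? (map ∣_∣ w))
              (words n (map +_ (range1 n) ++ map (λ i → - (+ i)) (range1 n)))

-- des_k^B(π) = #{0 ≤ i ≤ n-k : π(i) > π(i+k)}, with π(0) = 0.
-- With w = (π(0),…,π(n)), the pairs (w[i], w[i+k]) for 0 ≤ i ≤ n-k are
-- exactly zip w (drop k w).
desB : ℕ → List ℤ → ℕ
desB k π = length (filter (λ { (a , b) → b ℤ.<? a }) (zip w (drop k w)))
  where w = + 0 ∷ π

-- lpeak_k(σ) = #{k ≤ i ≤ n-k : σ(i-k) < σ(i) > σ(i+k)}, with σ(0) = 0.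
-- With w = (σ(0),…,σ(n)) and j = i - k, the triples (w[j], w[j+k], w[j+2k])
-- for 0 ≤ j ≤ n-2k are zip w (zip (drop k w) (drop (2k) w)).
lpeak : ℕ → List ℕ → ℕ
lpeak k σ = length (filter (λ { (a , b , c) → a ℕ.<? b Relation.Nullary.Decidable.×-dec c ℕ.<? b })
                           (zip w (zip (drop k w) (drop (k + k) w))))
  where w = 0 ∷ σ

Gamma : ℕ → ℕ → ℕ → ℕ
Gamma n k p = length (filter (λ σ → lpeak k σ ℕ.≟ p) (Sn n))

gammaB : ℕ → ℕ → ℕ → ℕ
gammaB n k p = 2 ^ (2 * p + k ∸ 1) * Gamma n k p

WB : ℕ → ℕ → ℕ → ℕ
WB n k x = sum (map (λ π → x ^ desB k π) (Bn n))

gammaExpansion : ℕ → ℕ → ℕ → ℕ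
gammaExpansion n k x =
  sum (map (λ p → gammaB n k p * x ^ p * (1 + x) ^ (n ∸ k + 1 ∸ 2 * p))
           (upTo (suc ((n ∸ k + 1) / 2))))

-- Split a signed permutation into its absolute values σ ∈ S_n and its signs. With π(0) = 0, des_k^B
-- only compares entries in the same residue class mod k (a chain), so the signs can be summed out one
-- entry at a time from the left. Once the sign of an entry is summed out, the entry influences its
-- chain successor only as if it were absent or as if it were 0 (the latter when the chain ascends into
-- the successor). Summing over the sign of an entry whose predecessor is absent or 0 gives a factor 2
-- or 1 + x, except for a 0-like predecessor followed by a descent, i.e. a left peak of σ, which gives
-- 2x. Hence Σ_ε x^des = 2^(2p+k-1) x^p (1+x)^(n-k+1-2p) with p = lpeak_k(σ), where the power of 2
-- comes from a telescoping count of absent predecessors; grouping the σ by p gives the expansion.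

module Submission where

open import Defs
open import Data.Nat using (ℕ; zero; suc; _+_; _*_; _∸_; _^_; _≤_; _<_; z≤n; s≤s; s≤s⁻¹; s<s⁻¹)
import Data.Nat as ℕ
open import Data.Nat.Properties
open import Data.Nat.ListAction using (sum)
open import Data.Nat.DivMod using (_/_; m*n/n≡m; /-monoˡ-≤)
open import Data.Nat.ListAction.Properties using (sum-++)
open import Data.Integer as ℤ using (ℤ; +_; -_; -[1+_]; ∣_∣; +<+; -<+; -<-)
open import Data.List
  using (List; []; _∷_; map; concatMap; filter; length; upTo; drop; take; zip; replicate; _++_; _∷ʳ_)
open import Data.Maybe as Maybe using (Maybe; just; nothing)
open import Data.List.Properties
  using (map-++; ++-assoc; ++-identityʳ; map-∘; map-cong; map-cong-local; map-replicate; length-map; length-++;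
         length-replicate; take-all; drop-all; drop-map; drop-drop; upTo-∷ʳ; filter-++; zipWith-zeroʳ)
open import Data.List.Membership.Propositional using (_∈_; find)
open import Data.List.Membership.Propositional.Properties using (∈-concatMap⁻; ∈-map⁻; ∈-filter⁻)
open import Data.List.Relation.Unary.Unique.DecPropositional ℕ._≟_ using (unique?)
open import Data.List.Relation.Unary.All as All using (All; []; _∷_)
open import Data.List.Relation.Unary.All.Properties using (drop⁺)
open import Data.List.Relation.Unary.AllPairs using (AllPairs; []; _∷_)
open import Data.Nat.Tactic.RingSolver using (solve-∀)
open import Data.List.Relation.Unary.Any using (here)
open import Data.Bool using (Bool; true; false; if_then_else_)
open import Data.Product using (_×_; _,_; proj₁; proj₂)
open import Relation.Nullary using (does; yes; no; Dec; ¬_)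
open import Relation.Nullary.Decidable using (dec-true; dec-false; _×-dec_)
open import Relation.Unary using (Pred; Decidable)
open import Relation.Binary.PropositionalEquality
open import Function using (_∘_)
open import Data.Empty using (⊥-elim)
open import Level using (Level)
open import Algebra.Properties.CommutativeSemigroup +-commutativeSemigroup using (interchange; x∙yz≈y∙xz)

private variable
  A B : Set

∑ : List A → (A → ℕ) → ℕ
∑ xs f = sum (map f xs)

infix 5 ∑
syntax ∑ xs (λ a → e) = ∑[ a ← xs ] e

∑-++ : (xs ys : List A) (f : A → ℕ) → ∑ (xs ++ ys) f ≡ ∑ xs f + ∑ ys f
∑-++ xs ys f = trans (cong sum (map-++ f xs ys)) (sum-++ (map f xs) (map f ys))

∑-map : (g : A → B) (xs : List A) (f : B → ℕ) → ∑ (map g xs) f ≡ ∑[ x ← xs ] f (g x)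
∑-map g xs f = cong sum (sym (map-∘ xs))

∑-cong : {f g : A → ℕ} (xs : List A) → (∀ x → f x ≡ g x) → ∑ xs f ≡ ∑ xs g
∑-cong xs f≗g = cong sum (map-cong f≗g xs)

∑-cong-∈ : {f g : A → ℕ} (xs : List A) → (∀ {x} → x ∈ xs → f x ≡ g x) → ∑ xs f ≡ ∑ xs g
∑-cong-∈ xs f≗g = cong sum (map-cong-local (All.tabulate f≗g))

∑-concatMap : (h : A → List B) (xs : List A) (f : B → ℕ) →
              ∑ (concatMap h xs) f ≡ ∑[ x ← xs ] ∑ (h x) f
∑-concatMap h []       f = refl
∑-concatMap h (x ∷ xs) f =
  trans (∑-++ (h x) (concatMap h xs) f) (cong (_+_ (∑ (h x) f)) (∑-concatMap h xs f))

∑-const : (xs : List A) (c : ℕ) → ∑[ x ← xs ] c ≡ length xs * c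
∑-const []       c = refl
∑-const (x ∷ xs) c = cong (_+_ c) (∑-const xs c)

∑-zero : (xs : List A) → ∑[ x ← xs ] 0 ≡ 0
∑-zero xs = trans (∑-const xs 0) (*-zeroʳ (length xs))

∑-+ : (xs : List A) (f g : A → ℕ) → ∑[ x ← xs ] (f x + g x) ≡ ∑ xs f + ∑ xs g
∑-+ []       f g = refl
∑-+ (x ∷ xs) f g = trans (cong (_+_ (f x + g x)) (∑-+ xs f g)) (interchange (f x) (g x) (∑ xs f) (∑ xs g))

∑-*ˡ : (c : ℕ) (xs : List A) (f : A → ℕ) → ∑[ x ← xs ] (c * f x) ≡ c * ∑ xs f
∑-*ˡ c []       f = sym (*-zeroʳ c)
∑-*ˡ c (x ∷ xs) f = trans (cong (_+_ (c * f x)) (∑-*ˡ c xs f)) (sym (*-distribˡ-+ c (f x) (∑ xs f)))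

∑-comm : (xs : List A) (ys : List B) (f : A → B → ℕ) →
         ∑[ x ← xs ] ∑[ y ← ys ] f x y ≡ ∑[ y ← ys ] ∑[ x ← xs ] f x y
∑-comm []       ys f = sym (∑-zero ys)
∑-comm (x ∷ xs) ys f =
  trans (cong (_+_ (∑ ys (f x))) (∑-comm xs ys f)) (sym (∑-+ ys (f x) (λ y → ∑[ x ← xs ] f x y)))

module _ {p : Level} {P : Pred A p} (P? : Decidable P) where

  ∑-filter : (xs : List A) (f : A → ℕ) → ∑ (filter P? xs) f ≡ ∑[ x ← xs ] (if does (P? x) then f x else 0)
  ∑-filter []       f = refl
  ∑-filter (x ∷ xs) f with does (P? x)
  ... | true  = cong (_+_ (f x)) (∑-filter xs f)
  ... | false = ∑-filter xs f

  length-filter-* : (xs : List A) (c : ℕ) → length (filter P? xs) * c ≡ ∑[ x ← xs ] (if does (P? x) then c else 0)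
  length-filter-* xs c = trans (sym (∑-const (filter P? xs) c)) (∑-filter xs (λ _ → c))

∑-if : (b : Bool) (xs : List A) (f : A → ℕ) →
       ∑[ x ← xs ] (if b then f x else 0) ≡ (if b then ∑ xs f else 0)
∑-if true  xs f = refl
∑-if false xs f = ∑-zero xs

∑-upTo-suc : (N : ℕ) (f : ℕ → ℕ) → ∑ (upTo (suc N)) f ≡ ∑ (upTo N) f + f N
∑-upTo-suc N f = begin
  ∑ (upTo (suc N)) f        ≡⟨ cong (λ ps → ∑ ps f) (sym (upTo-∷ʳ N)) ⟩
  ∑ (upTo N ++ N ∷ []) f    ≡⟨ ∑-++ (upTo N) (N ∷ []) f ⟩
  ∑ (upTo N) f + (f N + 0)  ≡⟨ cong (_+_ (∑ (upTo N) f)) (+-identityʳ (f N)) ⟩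
  ∑ (upTo N) f + f N        ∎
  where open ≡-Reasoning

module _ (h : ℕ → ℕ) (q : ℕ) where

  private
    δ : ℕ → ℕ
    δ p = if does (q ℕ.≟ p) then h p else 0

    δ-miss : ∀ {p} → q ≢ p → δ p ≡ 0
    δ-miss {p} q≢p = cong (λ b → if b then h p else 0) (dec-false (q ℕ.≟ p) q≢p)

  ∑-upTo-δ-miss : ∀ N → N ≤ q → ∑[ p ← upTo N ] (if does (q ℕ.≟ p) then h p else 0) ≡ 0
  ∑-upTo-δ-miss zero    _   = refl
  ∑-upTo-δ-miss (suc N) N<q = begin
    ∑ (upTo (suc N)) δ  ≡⟨ ∑-upTo-suc N δ ⟩
    ∑ (upTo N) δ + δ N  ≡⟨ cong₂ _+_ (∑-upTo-δ-miss N (<⇒≤ N<q)) (δ-miss (>⇒≢ N<q)) ⟩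
    0                   ∎
    where open ≡-Reasoning

  ∑-upTo-δ : ∀ N → q < N → ∑[ p ← upTo N ] (if does (q ℕ.≟ p) then h p else 0) ≡ h q
  ∑-upTo-δ (suc N) q<1+N = trans (∑-upTo-suc N δ) (lastOrEarlier (q ℕ.≟ N))
    where
    lastOrEarlier : Dec (q ≡ N) → ∑ (upTo N) δ + δ N ≡ h q
    lastOrEarlier (yes refl) =
      cong₂ _+_ (∑-upTo-δ-miss N ≤-refl) (cong (λ b → if b then h q else 0) (dec-true (q ℕ.≟ q) refl))
    lastOrEarlier (no q≢N)   =
      trans (cong₂ _+_ (∑-upTo-δ N (≤∧≢⇒< (s≤s⁻¹ q<1+N) q≢N)) (δ-miss q≢N)) (+-identityʳ (h q))

∑-fibres : (f : A → ℕ) (h : ℕ → ℕ) (N : ℕ) (xs : List A) → All (λ x → f x < N) xs →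
           ∑[ x ← xs ] h (f x) ≡ ∑[ p ← upTo N ] (length (filter (λ x → f x ℕ.≟ p) xs) * h p)
∑-fibres f h N xs bounded = begin
  ∑[ x ← xs ] h (f x)
    ≡⟨ sym (∑-cong-∈ xs (λ x∈xs → ∑-upTo-δ h (f _) N (All.lookup bounded x∈xs))) ⟩
  ∑[ x ← xs ] ∑[ p ← upTo N ] (if does (f x ℕ.≟ p) then h p else 0)
    ≡⟨ ∑-comm xs (upTo N) _ ⟩
  ∑[ p ← upTo N ] ∑[ x ← xs ] (if does (f x ℕ.≟ p) then h p else 0)
    ≡⟨ sym (∑-cong (upTo N) (λ p → length-filter-* (λ x → f x ℕ.≟ p) xs (h p))) ⟩
  ∑[ p ← upTo N ] (length (filter (λ x → f x ℕ.≟ p) xs) * h p) ∎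
  where open ≡-Reasoning

∑-words-suc : (n : ℕ) (as : List A) (g : List A → ℕ) →
              ∑ (words (suc n) as) g ≡ ∑[ a ← as ] ∑[ w ← words n as ] g (a ∷ w)
∑-words-suc n as g = trans (∑-concatMap _ as g) (∑-cong as (λ a → ∑-map (a ∷_) (words n as) g))

∈-words⁻ : ∀ n {as : List A} {w} → w ∈ words n as → length w ≡ n × All (_∈ as) w
∈-words⁻ zero    (here refl) = refl , []
∈-words⁻ (suc n) {as} w∈     with find (∈-concatMap⁻ (λ a → map (a ∷_) (words n as)) {xs = as} w∈)
... | a , a∈as , w∈a∷words with ∈-map⁻ (a ∷_) w∈a∷words
... | w′ , w′∈words , refl with ∈-words⁻ n w′∈words
... | length≡n , all∈ = cong suc length≡n , a∈as ∷ all∈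

sign : Bool → ℕ → ℤ
sign true  a = + a
sign false a = - (+ a)

bools : List Bool
bools = true ∷ false ∷ []

-- Missing signs count as +; the sums below only use sign vectors of full length.
signed : List Bool → List ℕ → List ℤ
signed []      v       = map +_ v
signed (e ∷ ε) []      = []
signed (e ∷ ε) (a ∷ v) = sign e a ∷ signed ε v

∣sign∣ : ∀ e a → ∣ sign e a ∣ ≡ a
∣sign∣ true  a       = refl
∣sign∣ false zero    = refl
∣sign∣ false (suc a) = refl

∣signed∣ : ∀ ε v → map ∣_∣ (signed ε v) ≡ v
∣signed∣ []      []      = refl
∣signed∣ []      (a ∷ v) = cong (a ∷_) (∣signed∣ [] v)
∣signed∣ (e ∷ ε) []      = refl
∣signed∣ (e ∷ ε) (a ∷ v) = cong₂ _∷_ (∣sign∣ e a) (∣signed∣ ε v)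

signed-[] : ∀ ε → signed ε [] ≡ []
signed-[] []      = refl
signed-[] (e ∷ ε) = refl

drop-signed : ∀ j ε v → drop j (signed ε v) ≡ signed (drop j ε) (drop j v)
drop-signed zero    ε       v       = refl
drop-signed (suc j) []      v       = drop-map (suc j) v
drop-signed (suc j) (e ∷ ε) []      = sym (signed-[] (drop j ε))
drop-signed (suc j) (e ∷ ε) (a ∷ v) = drop-signed j ε v

∑-± : (as : List ℕ) (h : ℤ → ℕ) →
      ∑ (map +_ as ++ map (λ i → - (+ i)) as) h ≡ ∑[ a ← as ] ∑[ e ← bools ] h (sign e a)
∑-± as h = begin
  ∑ (map +_ as ++ map (λ i → - (+ i)) as) h
    ≡⟨ ∑-++ (map +_ as) _ h ⟩
  ∑ (map +_ as) h + ∑ (map (λ i → - (+ i)) as) h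
    ≡⟨ cong₂ _+_ (∑-map +_ as h) (∑-map (λ i → - (+ i)) as h) ⟩
  (∑[ a ← as ] h (+ a)) + (∑[ a ← as ] h (- (+ a)))
    ≡⟨ sym (∑-+ as _ _) ⟩
  ∑[ a ← as ] (h (+ a) + h (- (+ a)))
    ≡⟨ ∑-cong as (λ a → cong (_+_ (h (+ a))) (sym (+-identityʳ (h (- (+ a)))))) ⟩
  ∑[ a ← as ] ∑[ e ← bools ] h (sign e a) ∎
  where open ≡-Reasoning

∑-words-signed : (as : List ℕ) (n : ℕ) (g : List ℤ → ℕ) →
                 ∑ (words n (map +_ as ++ map (λ i → - (+ i)) as)) g
                 ≡ ∑[ v ← words n as ] ∑[ ε ← words n bools ] g (signed ε v)
∑-words-signed as zero    g = cong (_+ 0) (sym (+-identityʳ (g [])))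
∑-words-signed as (suc n) g = begin
  ∑ (words (suc n) ±as) g
    ≡⟨ ∑-words-suc n ±as g ⟩
  ∑[ c ← ±as ] ∑[ w ← words n ±as ] g (c ∷ w)
    ≡⟨ ∑-cong ±as (λ c → ∑-words-signed as n (λ w → g (c ∷ w))) ⟩
  ∑[ c ← ±as ] ∑[ v ← words n as ] ∑[ ε ← words n bools ] g (c ∷ signed ε v)
    ≡⟨ ∑-± as _ ⟩
  ∑[ a ← as ] ∑[ e ← bools ] ∑[ v ← words n as ] ∑[ ε ← words n bools ] g (sign e a ∷ signed ε v)
    ≡⟨ ∑-cong as (λ a → ∑-comm bools (words n as)
                                (λ e v → ∑[ ε ← words n bools ] g (sign e a ∷ signed ε v))) ⟩
  ∑[ a ← as ] ∑[ v ← words n as ] ∑[ e ← bools ] ∑[ ε ← words n bools ] g (signed (e ∷ ε) (a ∷ v))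
    ≡⟨ ∑-cong as (λ a → ∑-cong (words n as) (λ v →
         sym (∑-words-suc n bools (λ ε → g (signed ε (a ∷ v)))))) ⟩
  ∑[ a ← as ] ∑[ v ← words n as ] ∑[ ε ← words (suc n) bools ] g (signed ε (a ∷ v))
    ≡⟨ sym (∑-words-suc n as (λ v → ∑[ ε ← words (suc n) bools ] g (signed ε v))) ⟩
  ∑[ v ← words (suc n) as ] ∑[ ε ← words (suc n) bools ] g (signed ε v) ∎
  where
  open ≡-Reasoning
  ±as = map +_ as ++ map (λ i → - (+ i)) as

∑-Bn : ∀ n (g : List ℤ → ℕ) → ∑ (Bn n) g ≡ ∑[ σ ← Sn n ] ∑[ ε ← words n bools ] g (signed ε σ)
∑-Bn n g = begin
  ∑ (Bn n) g
    ≡⟨ ∑-filter (λ w → unique? (map ∣_∣ w)) (words n ±[n]) g ⟩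
  ∑[ π ← words n ±[n] ] (if does (unique? (map ∣_∣ π)) then g π else 0)
    ≡⟨ ∑-words-signed (range1 n) n _ ⟩
  ∑[ σ ← words n (range1 n) ] ∑[ ε ← words n bools ]
    (if does (unique? (map ∣_∣ (signed ε σ))) then g (signed ε σ) else 0)
    ≡⟨ ∑-cong (words n (range1 n)) (λ σ → ∑-cong (words n bools) (λ ε →
         cong (λ w → if does (unique? w) then g (signed ε σ) else 0) (∣signed∣ ε σ))) ⟩
  ∑[ σ ← words n (range1 n) ] ∑[ ε ← words n bools ] (if does (unique? σ) then g (signed ε σ) else 0)
    ≡⟨ ∑-cong (words n (range1 n)) (λ σ →
         ∑-if (does (unique? σ)) (words n bools) (λ ε → g (signed ε σ))) ⟩
  ∑[ σ ← words n (range1 n) ] (if does (unique? σ) then ∑[ ε ← words n bools ] g (signed ε σ) else 0)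
    ≡⟨ sym (∑-filter (λ w → unique? w) (words n (range1 n)) _) ⟩
  ∑[ σ ← Sn n ] ∑[ ε ← words n bools ] g (signed ε σ) ∎
  where
  open ≡-Reasoning
  ±[n] = map +_ (range1 n) ++ map (λ i → - (+ i)) (range1 n)

∈-Sn⁻ : ∀ n {σ} → σ ∈ Sn n → length σ ≡ n × All (1 ≤_) σ × AllPairs _≢_ σ
∈-Sn⁻ n σ∈Sn with ∈-filter⁻ (λ w → unique? w) σ∈Sn
... | σ∈words , distinct with ∈-words⁻ n σ∈words
... | length≡n , entries = length≡n , All.map positive entries , distinct
  where
  positive : ∀ {a} → a ∈ range1 n → 1 ≤ a
  positive a∈ with ∈-map⁻ suc a∈
  ... | _ , _ , refl = s≤s z≤n

drop-++-∷ : (j : ℕ) (p : List A) {c c′ : A} {r : List A} → length p < j →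
            drop j (p ++ c ∷ r) ≡ drop j (p ++ c′ ∷ r)
drop-++-∷ (suc j) []      _       = refl
drop-++-∷ (suc j) (d ∷ p) (s≤s p<j) = drop-++-∷ j p p<j

drop-++-length : (p r : List A) → drop (length p) (p ++ r) ≡ r
drop-++-length []      r = refl
drop-++-length (d ∷ p) r = drop-++-length p r

drop-suc : (j : ℕ) (w : List A) → drop 1 (drop j w) ≡ drop (suc j) w
drop-suc j w = trans (drop-drop j 1 w) (cong (λ i → drop i w) (+-comm j 1))

zip-∷ : (c : A) (w : List A) (ys : List B) → zip (c ∷ w) ys ≡ zip (c ∷ []) ys ++ zip w (drop 1 ys)
zip-∷ c w []       = sym (zipWith-zeroʳ _,_ w)
zip-∷ c w (y ∷ ys) = refl

drop-zip : {C : Set} (ys : List B) (zs : List C) → drop 1 (zip ys zs) ≡ zip (drop 1 ys) (drop 1 zs)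
drop-zip []       zs       = refl
drop-zip (y ∷ ys) []       = sym (zipWith-zeroʳ _,_ ys)
drop-zip (y ∷ ys) (z ∷ zs) = refl

module _ {p : Level} {P : Pred A p} (P? : Decidable P) where

  count-++ : (xs ys : List A) → length (filter P? (xs ++ ys)) ≡ length (filter P? xs) + length (filter P? ys)
  count-++ xs ys = trans (cong length (filter-++ P? xs ys)) (length-++ (filter P? xs))

indicator : {ℓ : Level} {P : Set ℓ} → Dec P → ℕ
indicator P? = if does P? then 1 else 0

count-singleton : {p : Level} {P : Pred A p} (P? : Decidable P) (x : A) →
                  length (filter P? (x ∷ [])) ≡ indicator (P? x)
count-singleton P? x with does (P? x)
... | true  = refl
... | false = refl

indicator-yes : {ℓ : Level} {P : Set ℓ} (P? : Dec P) → P → indicator P? ≡ 1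
indicator-yes P? p = cong (λ β → if β then 1 else 0) (dec-true P? p)

indicator-no : {ℓ : Level} {P : Set ℓ} (P? : Dec P) → ¬ P → indicator P? ≡ 0
indicator-no P? ¬p = cong (λ β → if β then 1 else 0) (dec-false P? ¬p)

indicator-cong : {ℓ : Level} {P Q : Set ℓ} (P? : Dec P) (Q? : Dec Q) →
                 (P → Q) → (Q → P) → indicator P? ≡ indicator Q?
indicator-cong (yes p) (yes q) _   _   = refl
indicator-cong (no ¬p) (no ¬q) _   _   = refl
indicator-cong (yes p) (no ¬q) P⇒Q _   = ⊥-elim (¬q (P⇒Q p))
indicator-cong (no ¬p) (yes q) _   Q⇒P = ⊥-elim (¬p (Q⇒P q))

headᵐ : List (Maybe A) → Maybe A
headᵐ []      = nothing
headᵐ (y ∷ _) = y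

∣head-signed∣ : ∀ ε v → Maybe.map ∣_∣ (headᵐ (map just (signed ε v))) ≡ headᵐ (map just v)
∣head-signed∣ []      []      = refl
∣head-signed∣ []      (a ∷ v) = refl
∣head-signed∣ (e ∷ ε) []      = refl
∣head-signed∣ (e ∷ ε) (a ∷ v) = cong just (∣sign∣ e a)

descent : Maybe ℤ → Maybe ℤ → ℕ
descent (just a) (just b) = indicator (b ℤ.<? a)
descent _        _        = 0

peak : Maybe ℕ → Maybe ℕ → Maybe ℕ → ℕ
peak (just a) (just b) (just c) = indicator (a ℕ.<? b ×-dec c ℕ.<? b)
peak _        _        _        = 0

marker : A → Bool → Maybe A
marker z false = nothing
marker z true  = just z

-- The flags in front of a frame stand for the chain predecessors, with signs already summed out, of
-- the next entries of v: nothing if there is none, just z (z = 0) if it is smaller, since after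
-- summing over its sign such a predecessor acts like 0. The initial window makes π(0) = 0 the
-- predecessor of π(k) and leaves π(1), …, π(k-1) without one.
frame : A → List Bool → List A → List (Maybe A)
frame z t v = map (marker z) t ++ map just v

frame-∷ʳ : (z : A) (ts : List Bool) (b : Bool) (v : List A) →
           frame z (ts ∷ʳ b) v ≡ map (marker z) ts ++ marker z b ∷ map just v
frame-∷ʳ z ts b v = trans (cong (_++ map just v) (map-++ (marker z) ts (b ∷ []))) (++-assoc (map (marker z) ts) _ _)

data Link : Set where
  last down up : Link

link : ℕ → List ℕ → Link
link a []      = last
link a (b ∷ _) with b ℕ.<? a
... | yes _ = down
... | no  _ = up

ascends : Link → Bool
ascends down = false
ascends _    = true

data Follows (a : ℕ) : Link → Maybe ℕ → Set where
  last : Follows a last nothing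
  down : ∀ {b} → b < a → Follows a down (just b)
  up   : ∀ {b} → a < b → Follows a up (just b)

follows : ∀ a vs → All (a ≢_) vs → Follows a (link a vs) (headᵐ (map just vs))
follows a []       _          = last
follows a (b ∷ vs) (a≢b ∷ _) with b ℕ.<? a
... | yes b<a = down b<a
... | no  b≮a = up (≤∧≢⇒< (≮⇒≥ b≮a) a≢b)

Step : Set
Step = Bool × Link

-- 2 ^ exp₂ s * x ^ expₓ s * (1 + x) ^ exp₁₊ₓ s is the sum over the sign of an entry (descent-step):
-- 2, 1 + x, 2 for an absent predecessor and 1 + x, 2x, 1 + x for a 0-like one (last, down, up).
exp₂ expₓ exp₁₊ₓ : Step → ℕ
exp₂ (true  , down) = 1
exp₂ (false , down) = 0
exp₂ (true  , _)    = 0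
exp₂ (false , _)    = 1
expₓ (true  , down) = 1
expₓ _              = 0
exp₁₊ₓ s = 1 ∸ exp₂ s

falses : List Bool → ℕ
falses []           = 0
falses (false ∷ bs) = suc (falses bs)
falses (true  ∷ bs) = falses bs

falses-++ : ∀ bs cs → falses (bs ++ cs) ≡ falses bs + falses cs
falses-++ []           cs = refl
falses-++ (false ∷ bs) cs = cong suc (falses-++ bs cs)
falses-++ (true  ∷ bs) cs = falses-++ bs cs

falses-replicate : ∀ j → falses (replicate j false) ≡ j
falses-replicate zero    = refl
falses-replicate (suc j) = cong suc (falses-replicate j)

exp₂-telescopes : ∀ t s → exp₂ (t , s) + falses (ascends s ∷ []) ≡ 2 * expₓ (t , s) + falses (t ∷ [])
exp₂-telescopes true  last = refl
exp₂-telescopes true  down = refl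
exp₂-telescopes true  up   = refl
exp₂-telescopes false last = refl
exp₂-telescopes false down = refl
exp₂-telescopes false up   = refl

exp₂+exp₁₊ₓ : ∀ s → exp₂ s + exp₁₊ₓ s ≡ 1
exp₂+exp₁₊ₓ (true  , last) = refl
exp₂+exp₁₊ₓ (true  , down) = refl
exp₂+exp₁₊ₓ (true  , up)   = refl
exp₂+exp₁₊ₓ (false , last) = refl
exp₂+exp₁₊ₓ (false , down) = refl
exp₂+exp₁₊ₓ (false , up)   = refl

falses-take-∷ʳ-true : ∀ j bs → falses (take j (bs ∷ʳ true)) ≡ falses (take j bs)
falses-take-∷ʳ-true zero    bs           = refl
falses-take-∷ʳ-true (suc zero)    []      = refl
falses-take-∷ʳ-true (suc (suc j)) []      = refl
falses-take-∷ʳ-true (suc j) (false ∷ bs) = cong suc (falses-take-∷ʳ-true j bs)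
falses-take-∷ʳ-true (suc j) (true  ∷ bs) = falses-take-∷ʳ-true j bs

descent-0-pos : ∀ a → descent (just (+ 0)) (just (+ a)) ≡ 0
descent-0-pos a = indicator-no (+ a ℤ.<? + 0) (λ { (+<+ ()) })

descent-0-neg : ∀ a → descent (just (+ 0)) (just -[1+ a ]) ≡ 1
descent-0-neg a = indicator-yes (-[1+ a ] ℤ.<? + 0) -<+

descent-below : ∀ {a} z → ∣ z ∣ < suc a →
                descent (just (+ suc a)) (just z) ≡ 1 × descent (just -[1+ a ]) (just z) ≡ 0
descent-below {a} (+ b)    b<1+a   =
  indicator-yes (+ b ℤ.<? + suc a) (+<+ b<1+a) , indicator-no (+ b ℤ.<? -[1+ a ]) (λ ())
descent-below {a} -[1+ b ] 1+b<1+a =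
  indicator-yes (-[1+ b ] ℤ.<? + suc a) -<+ ,
  indicator-no (-[1+ b ] ℤ.<? -[1+ a ]) (λ { (-<- a<b) → <-asym a<b (s<s⁻¹ 1+b<1+a) })

descent-above : ∀ {a} z → suc a < ∣ z ∣ →
                descent (just (+ suc a)) (just z) ≡ descent (just (+ 0)) (just z)
                × descent (just -[1+ a ]) (just z) ≡ descent (just (+ 0)) (just z)
descent-above {a} (+ b)    1+a<b   =
  indicator-cong (+ b ℤ.<? + suc a) (+ b ℤ.<? + 0)
                 (λ { (+<+ b<1+a) → ⊥-elim (<-asym b<1+a 1+a<b) }) (λ { (+<+ ()) }) ,
  indicator-cong (+ b ℤ.<? -[1+ a ]) (+ b ℤ.<? + 0) (λ ()) (λ { (+<+ ()) })
descent-above {a} -[1+ b ] 1+a<1+b =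
  indicator-cong (-[1+ b ] ℤ.<? + suc a) (-[1+ b ] ℤ.<? + 0) (λ _ → -<+) (λ _ → -<+) ,
  indicator-cong (-[1+ b ] ℤ.<? -[1+ a ]) (-[1+ b ] ℤ.<? + 0) (λ _ → -<+) (λ _ → -<- (s<s⁻¹ 1+a<1+b))

peak-0-0 : ∀ z → peak (just 0) (just 0) z ≡ 0
peak-0-0 nothing  = refl
peak-0-0 (just c) = indicator-no (0 ℕ.<? 0 ×-dec c ℕ.<? 0) (λ (0<0 , _) → <-irrefl refl 0<0)

peak-descending : ∀ {a b} → b < a → ∀ z → peak (just a) (just b) z ≡ 0
peak-descending b<a nothing  = refl
peak-descending {a} {b} b<a (just c) = indicator-no (a ℕ.<? b ×-dec c ℕ.<? b) (λ (a<b , _) → <-asym a<b b<a)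

peak-ascending : ∀ {a b} → a < b → ∀ z → peak (just a) (just b) z ≡ peak (just 0) (just b) z
peak-ascending a<b nothing  = refl
peak-ascending {a} {b} a<b (just c) =
  indicator-cong (a ℕ.<? b ×-dec c ℕ.<? b) (0 ℕ.<? b ×-dec c ℕ.<? b)
                 (λ (_ , c<b) → ≤-<-trans z≤n a<b , c<b) (λ (_ , c<b) → a<b , c<b)

peak-step : ∀ t {a s b?} → Follows a s b? → ∀ z →
            peak (marker 0 t) (just a) b? + peak (just a) b? z ≡ expₓ (t , s) + peak (marker 0 (ascends s)) b? z
peak-step false last       z = refl
peak-step true  last       z = refl
peak-step false (down b<a) z = peak-descending b<a z
peak-step true  {a} (down {b} b<a) z =
  cong₂ _+_ (indicator-yes (0 ℕ.<? a ×-dec b ℕ.<? a) (≤-<-trans z≤n b<a , b<a)) (peak-descending b<a z)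
peak-step false (up a<b)   z = peak-ascending a<b z
peak-step true  {a} (up {b} a<b)   z =
  cong₂ _+_ (indicator-no (0 ℕ.<? a ×-dec b ℕ.<? a) (λ (_ , b<a) → <-asym a<b b<a)) (peak-ascending a<b z)

∸-suc-+1 : ∀ {m n} → suc m ≤ n → n ∸ suc m + 1 ≡ n ∸ m
∸-suc-+1 {m} {n} k≤n = trans (sym (+-∸-comm 1 k≤n)) (cong (_∸ suc m) (+-comm n 1))

module Window (m : ℕ) where

  windowSum : (A → List A → ℕ) → List A → ℕ
  windowSum f []      = 0
  windowSum f (c ∷ r) = f c (drop m r) + windowSum f r

  windowSum-cong : {f g : A → List A → ℕ} → (∀ c l → f c l ≡ g c l) →
                   ∀ w → windowSum f w ≡ windowSum g w
  windowSum-cong f≗g []      = refl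
  windowSum-cong f≗g (c ∷ r) = cong₂ _+_ (f≗g c (drop m r)) (windowSum-cong f≗g r)

  windowSum-map : (f : B → List B → ℕ) (g : A → B) (w : List A) →
                  windowSum f (map g w) ≡ windowSum (λ c l → f (g c) (map g l)) w
  windowSum-map f g []      = refl
  windowSum-map f g (c ∷ r) = cong₂ _+_ (cong (f (g c)) (drop-map m r)) (windowSum-map f g r)

  windowSum-map-zero : (f : B → List B → ℕ) (g : A → B) → (∀ c l → f (g c) (map g l) ≡ 0) →
                       ∀ w → windowSum f (map g w) ≡ 0
  windowSum-map-zero f g vanish w = trans (windowSum-map f g w) (go w)
    where
    go : ∀ w → windowSum (λ c l → f (g c) (map g l)) w ≡ 0
    go []      = refl
    go (c ∷ r) = cong₂ _+_ (vanish c (drop m r)) (go r)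

  module _ {f : A → List A → ℕ} (z : A) (inert : ∀ l → f z l ≡ 0) where

    windowSum-replace : ∀ p {c r} → length p ≤ m →
                        windowSum f (p ++ c ∷ r) ≡ f c (drop m r) + windowSum f (p ++ z ∷ r)
    windowSum-replace []      {c} {r} _ = cong (_+_ (f c (drop m r))) (sym (cong (_+ windowSum f r) (inert (drop m r))))
    windowSum-replace (d ∷ p) {c} {r} p<m = begin
      f d (drop m (p ++ c ∷ r)) + windowSum f (p ++ c ∷ r)
        ≡⟨ cong₂ _+_ (cong (f d) (drop-++-∷ m p p<m)) (windowSum-replace p (<⇒≤ p<m)) ⟩
      f d (drop m (p ++ z ∷ r)) + (f c (drop m r) + windowSum f (p ++ z ∷ r))
        ≡⟨ x∙yz≈y∙xz (f d (drop m (p ++ z ∷ r))) (f c (drop m r)) (windowSum f (p ++ z ∷ r)) ⟩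
      f c (drop m r) + (f d (drop m (p ++ z ∷ r)) + windowSum f (p ++ z ∷ r)) ∎
      where open ≡-Reasoning

    windowSum-slide : ∀ c₀ p {c r} → length p ≡ m →
                      windowSum f (c₀ ∷ p ++ c ∷ r)
                      ≡ (f c₀ (c ∷ r) + f c (drop m r)) + windowSum f (p ++ z ∷ r)
    windowSum-slide c₀ p {c} {r} refl = begin
      f c₀ (drop (length p) (p ++ c ∷ r)) + windowSum f (p ++ c ∷ r)
        ≡⟨ cong₂ _+_ (cong (f c₀) (drop-++-length p (c ∷ r))) (windowSum-replace p ≤-refl) ⟩
      f c₀ (c ∷ r) + (f c (drop m r) + windowSum f (p ++ z ∷ r))
        ≡⟨ sym (+-assoc (f c₀ (c ∷ r)) (f c (drop m r)) (windowSum f (p ++ z ∷ r))) ⟩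
      (f c₀ (c ∷ r) + f c (drop m r)) + windowSum f (p ++ z ∷ r) ∎
      where open ≡-Reasoning

    windowSum-replicate : ∀ j l → windowSum f (replicate j z ++ l) ≡ windowSum f l
    windowSum-replicate zero    l = refl
    windowSum-replicate (suc j) l =
      trans (cong (_+ windowSum f (replicate j z ++ l)) (inert (drop m (replicate j z ++ l))))
            (windowSum-replicate j l)

  module _ {p : Level} where

    count-pairs : {P : Pred (A × A) p} (P? : Decidable P) (w : List A) →
                  length (filter P? (zip w (drop (suc m) w)))
                  ≡ windowSum (λ c l → length (filter P? (zip (c ∷ []) l))) w
    count-pairs P? []      = refl
    count-pairs P? (c ∷ w) = begin
      length (filter P? (zip (c ∷ w) (drop m w)))
        ≡⟨ cong (length ∘ filter P?) (zip-∷ c w (drop m w)) ⟩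
      length (filter P? (zip (c ∷ []) (drop m w) ++ zip w (drop 1 (drop m w))))
        ≡⟨ count-++ P? (zip (c ∷ []) (drop m w)) _ ⟩
      atHead + length (filter P? (zip w (drop 1 (drop m w))))
        ≡⟨ cong (λ ys → atHead + length (filter P? (zip w ys))) (drop-suc m w) ⟩
      atHead + length (filter P? (zip w (drop (suc m) w)))
        ≡⟨ cong (_+_ atHead) (count-pairs P? w) ⟩
      atHead + windowSum (λ c l → length (filter P? (zip (c ∷ []) l))) w ∎
      where
      open ≡-Reasoning
      atHead = length (filter P? (zip (c ∷ []) (drop m w)))

    count-triples : {P : Pred (A × A × A) p} (P? : Decidable P) (w : List A) →
                    length (filter P? (zip w (zip (drop (suc m) w) (drop (suc m + suc m) w))))
                    ≡ windowSum (λ c l → length (filter P? (zip (c ∷ []) (zip l (drop (suc m) l))))) w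
    count-triples P? []      = refl
    count-triples P? (c ∷ w) = begin
      length (filter P? (zip (c ∷ w) (zip ys zs)))
        ≡⟨ cong (length ∘ filter P?) (zip-∷ c w (zip ys zs)) ⟩
      length (filter P? (zip (c ∷ []) (zip ys zs) ++ zip w (drop 1 (zip ys zs))))
        ≡⟨ count-++ P? (zip (c ∷ []) (zip ys zs)) _ ⟩
      length (filter P? (zip (c ∷ []) (zip ys zs))) + length (filter P? (zip w (drop 1 (zip ys zs))))
        ≡⟨ cong₂ (λ zs′ ys′ → length (filter P? (zip (c ∷ []) (zip ys zs′)))
                                + length (filter P? (zip w ys′)))
                 (sym (drop-drop m (suc m) w)) shifted ⟩
      length (filter P? (zip (c ∷ []) (zip ys (drop (suc m) ys))))
        + length (filter P? (zip w (zip (drop (suc m) w) (drop (suc m + suc m) w))))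
        ≡⟨ cong (_+_ _) (count-triples P? w) ⟩
      _ ∎
      where
      open ≡-Reasoning
      ys = drop m w
      zs = drop (m + suc m) w
      shifted : drop 1 (zip ys zs) ≡ zip (drop (suc m) w) (drop (suc m + suc m) w)
      shifted = trans (drop-zip ys zs) (cong₂ zip (drop-suc m w) (drop-suc (m + suc m) w))

  descents : List (Maybe ℤ) → ℕ
  descents = windowSum (λ c l → descent c (headᵐ l))

  peaks : List (Maybe ℕ) → ℕ
  peaks = windowSum (λ c l → peak c (headᵐ l) (headᵐ (drop (suc m) l)))

  -- Stated for any decider with the right verdicts, to cover the anonymous predicates of desB and lpeak.
  module _ {p : Level} where

    count-pairs≡descents : {P : Pred (ℤ × ℤ) p} (P? : Decidable P) →
                           (∀ a b → does (P? (a , b)) ≡ does (b ℤ.<? a)) →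
                           ∀ w → length (filter P? (zip w (drop (suc m) w))) ≡ descents (map just w)
    count-pairs≡descents P? P≡> w = begin
      length (filter P? (zip w (drop (suc m) w)))
        ≡⟨ count-pairs P? w ⟩
      windowSum (λ c l → length (filter P? (zip (c ∷ []) l))) w
        ≡⟨ windowSum-cong atHead w ⟩
      windowSum (λ c l → descent (just c) (headᵐ (map just l))) w
        ≡⟨ sym (windowSum-map (λ c l → descent c (headᵐ l)) just w) ⟩
      descents (map just w) ∎
      where
      open ≡-Reasoning
      atHead : ∀ c l → length (filter P? (zip (c ∷ []) l)) ≡ descent (just c) (headᵐ (map just l))
      atHead c []      = refl
      atHead c (b ∷ l) = trans (count-singleton P? (c , b)) (cong (λ β → if β then 1 else 0) (P≡> c b))

    count-triples≡peaks : {P : Pred (ℕ × ℕ × ℕ) p} (P? : Decidable P) →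
                          (∀ a b c → does (P? (a , b , c)) ≡ does (a ℕ.<? b ×-dec c ℕ.<? b)) →
                          ∀ w → length (filter P? (zip w (zip (drop (suc m) w) (drop (suc m + suc m) w))))
                                ≡ peaks (map just w)
    count-triples≡peaks P? P≡peak w = begin
      length (filter P? (zip w (zip (drop (suc m) w) (drop (suc m + suc m) w))))
        ≡⟨ count-triples P? w ⟩
      windowSum (λ c l → length (filter P? (zip (c ∷ []) (zip l (drop (suc m) l))))) w
        ≡⟨ windowSum-cong atHead w ⟩
      windowSum (λ c l → peak (just c) (headᵐ (map just l)) (headᵐ (drop (suc m) (map just l)))) w
        ≡⟨ sym (windowSum-map (λ c l → peak c (headᵐ l) (headᵐ (drop (suc m) l))) just w) ⟩
      peaks (map just w) ∎
      where
      open ≡-Reasoning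
      atTriple : ∀ c b l r → length (filter P? (zip (c ∷ []) (zip (b ∷ l) r)))
                             ≡ peak (just c) (just b) (headᵐ (map just r))
      atTriple c b l []      = refl
      atTriple c b l (d ∷ r) =
        trans (count-singleton P? (c , b , d)) (cong (λ β → if β then 1 else 0) (P≡peak c b d))
      atHead : ∀ c l → length (filter P? (zip (c ∷ []) (zip l (drop (suc m) l))))
                       ≡ peak (just c) (headᵐ (map just l)) (headᵐ (drop (suc m) (map just l)))
      atHead c []      = refl
      atHead c (b ∷ l) = trans (atTriple c b l (drop m l)) (cong (peak (just c) (just b) ∘ headᵐ) (sym (drop-map m l)))

  desB≡descents : ∀ π → desB (suc m) π ≡ descents (map just (+ 0 ∷ π))
  desB≡descents π = count-pairs≡descents _ (λ _ _ → refl) (+ 0 ∷ π)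

  lpeak≡peaks : ∀ σ → lpeak (suc m) σ ≡ peaks (map just (0 ∷ σ))
  lpeak≡peaks σ = count-triples≡peaks _ (λ _ _ _ → refl) (0 ∷ σ)

  run : List Bool → List ℕ → List Step
  run []       v       = []
  run (t ∷ ts) []      = []
  run (t ∷ ts) (a ∷ v) = (t , link a (drop m v)) ∷ run (ts ∷ʳ ascends (link a (drop m v))) v

  length-∷ʳ : (ts : List Bool) (b : Bool) → length ts ≡ m → length (ts ∷ʳ b) ≡ suc m
  length-∷ʳ ts b refl = trans (length-++ ts) (+-comm (length ts) 1)

  length-run : ∀ t v → length t ≡ suc m → length (run t v) ≡ length v
  length-run (t ∷ ts) []      _   = refl
  length-run (t ∷ ts) (a ∷ v) len = cong suc (length-run (ts ∷ʳ b) v (length-∷ʳ ts b (suc-injective len)))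
    where b = ascends (link a (drop m v))

  exp₂+exp₁₊ₓ-run : ∀ t v → length t ≡ suc m → ∑ (run t v) exp₂ + ∑ (run t v) exp₁₊ₓ ≡ length v
  exp₂+exp₁₊ₓ-run t v len = begin
    ∑ (run t v) exp₂ + ∑ (run t v) exp₁₊ₓ   ≡⟨ sym (∑-+ (run t v) exp₂ exp₁₊ₓ) ⟩
    ∑[ s ← run t v ] (exp₂ s + exp₁₊ₓ s)   ≡⟨ ∑-cong (run t v) exp₂+exp₁₊ₓ ⟩
    ∑[ s ← run t v ] 1                      ≡⟨ ∑-const (run t v) 1 ⟩
    length (run t v) * 1                    ≡⟨ *-identityʳ _ ⟩
    length (run t v)                        ≡⟨ length-run t v len ⟩
    length v                                ∎
    where open ≡-Reasoning

  exp₂-run-step : ∀ t ts a v → length ts ≡ m →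
              exp₂ (t , link a (drop m v)) + falses (take (length v) (ts ∷ʳ ascends (link a (drop m v))))
              ≡ 2 * expₓ (t , link a (drop m v)) + falses (t ∷ take (length v) ts)
  exp₂-run-step t ts a v len with m ℕ.<? length v
  ... | yes m<v = begin
    exp₂ (t , s) + falses (take (length v) (ts ∷ʳ ascends s))
      ≡⟨ cong (λ bs → exp₂ (t , s) + falses bs) (take-all (length v) (ts ∷ʳ ascends s) window≤v) ⟩
    exp₂ (t , s) + falses (ts ∷ʳ ascends s)
      ≡⟨ cong (_+_ (exp₂ (t , s))) (trans (falses-++ ts (ascends s ∷ [])) (+-comm (falses ts) _)) ⟩
    exp₂ (t , s) + (falses (ascends s ∷ []) + falses ts)
      ≡⟨ sym (+-assoc (exp₂ (t , s)) _ _) ⟩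
    exp₂ (t , s) + falses (ascends s ∷ []) + falses ts
      ≡⟨ cong (_+ falses ts) (exp₂-telescopes t s) ⟩
    2 * expₓ (t , s) + falses (t ∷ []) + falses ts
      ≡⟨ trans (+-assoc (2 * expₓ (t , s)) _ _) (cong (_+_ (2 * expₓ (t , s))) (sym (falses-++ (t ∷ []) ts))) ⟩
    2 * expₓ (t , s) + falses (t ∷ ts)
      ≡⟨ cong (λ bs → 2 * expₓ (t , s) + falses (t ∷ bs)) (sym (take-all (length v) ts ts≤v)) ⟩
    2 * expₓ (t , s) + falses (t ∷ take (length v) ts) ∎
    where
    open ≡-Reasoning
    s = link a (drop m v)
    window≤v : length (ts ∷ʳ ascends s) ≤ length v
    window≤v = subst (_≤ length v) (sym (length-∷ʳ ts (ascends s) len)) m<v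
    ts≤v : length ts ≤ length v
    ts≤v = subst (_≤ length v) (sym len) (<⇒≤ m<v)
  ... | no m≮v rewrite drop-all m v (≮⇒≥ m≮v) with t
  ...   | true  = falses-take-∷ʳ-true (length v) ts
  ...   | false = cong suc (falses-take-∷ʳ-true (length v) ts)

  exp₂-run : ∀ t v → length t ≡ suc m →
             ∑ (run t v) exp₂ ≡ 2 * ∑ (run t v) expₓ + falses (take (length v) t)
  exp₂-run (t ∷ ts) []      _   = refl
  exp₂-run (t ∷ ts) (a ∷ v) len = begin
    exp₂ (t , s) + ∑ (run ts′ v) exp₂
      ≡⟨ cong (_+_ (exp₂ (t , s))) (exp₂-run ts′ v (length-∷ʳ ts (ascends s) (suc-injective len))) ⟩
    exp₂ (t , s) + (2 * ∑ (run ts′ v) expₓ + falses (take (length v) ts′))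
      ≡⟨ shuffle (exp₂ (t , s)) (∑ (run ts′ v) expₓ) _ ⟩
    (exp₂ (t , s) + falses (take (length v) ts′)) + 2 * ∑ (run ts′ v) expₓ
      ≡⟨ cong (_+ 2 * ∑ (run ts′ v) expₓ) (exp₂-run-step t ts a v (suc-injective len)) ⟩
    (2 * expₓ (t , s) + falses (t ∷ take (length v) ts)) + 2 * ∑ (run ts′ v) expₓ
      ≡⟨ unshuffle (expₓ (t , s)) _ (∑ (run ts′ v) expₓ) ⟩
    2 * (expₓ (t , s) + ∑ (run ts′ v) expₓ) + falses (t ∷ take (length v) ts) ∎
    where
    open ≡-Reasoning
    s = link a (drop m v)
    ts′ = ts ∷ʳ ascends s
    shuffle : ∀ e q f → e + (2 * q + f) ≡ (e + f) + 2 * q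
    shuffle = solve-∀
    unshuffle : ∀ e f q → (2 * e + f) + 2 * q ≡ 2 * (e + q) + f
    unshuffle = solve-∀

  follows-next : ∀ a v → All (a ≢_) v → Follows a (link a (drop m v)) (headᵐ (drop m (map just v)))
  follows-next a v a∉v =
    subst (Follows a (link a (drop m v))) (cong headᵐ (sym (drop-map m v))) (follows a (drop m v) (drop⁺ m a∉v))

  peaks-markers : ∀ t → peaks (map (marker 0) t) ≡ 0
  peaks-markers = windowSum-map-zero _ (marker 0) vanish
    where
    vanish : ∀ c l → peak (marker 0 c) (headᵐ (map (marker 0) l)) (headᵐ (drop (suc m) (map (marker 0) l))) ≡ 0
    vanish false l           = refl
    vanish true  []          = refl
    vanish true  (false ∷ l) = refl
    vanish true  (true  ∷ l) = peak-0-0 (headᵐ (drop m (map (marker 0) l)))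

  peaks-run : ∀ t v → length t ≡ suc m → AllPairs _≢_ v → ∑ (run t v) expₓ ≡ peaks (frame 0 t v)
  peaks-run (t ∷ ts) []      _   _                =
    sym (trans (cong peaks (++-identityʳ (map (marker 0) (t ∷ ts)))) (peaks-markers (t ∷ ts)))
  peaks-run (t ∷ ts) (a ∷ v) len (a∉v ∷ distinct) = begin
    expₓ (t , s) + ∑ (run ts′ v) expₓ
      ≡⟨ cong (_+_ (expₓ (t , s))) (peaks-run ts′ v (length-∷ʳ ts (ascends s) (suc-injective len)) distinct) ⟩
    expₓ (t , s) + peaks (frame 0 ts′ v)
      ≡⟨ cong (λ l → expₓ (t , s) + peaks l) (frame-∷ʳ 0 ts (ascends s) v) ⟩
    expₓ (t , s) + peaks (P ++ marker 0 (ascends s) ∷ R)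
      ≡⟨ cong (_+_ (expₓ (t , s))) (windowSum-replace nothing (λ _ → refl) P (≤-reflexive lenP)) ⟩
    expₓ (t , s) + (peak (marker 0 (ascends s)) b? z + H)
      ≡⟨ sym (+-assoc (expₓ (t , s)) _ H) ⟩
    expₓ (t , s) + peak (marker 0 (ascends s)) b? z + H
      ≡⟨ cong (_+ H) (sym (peak-step t (follows-next a v a∉v) z)) ⟩
    peak (marker 0 t) (just a) b? + peak (just a) b? z + H
      ≡⟨ sym (windowSum-slide nothing (λ _ → refl) (marker 0 t) P lenP) ⟩
    peaks (frame 0 (t ∷ ts) (a ∷ v)) ∎
    where
    open ≡-Reasoning
    s = link a (drop m v)
    ts′ = ts ∷ʳ ascends s
    P = map (marker 0) ts
    R = map just v
    lenP : length P ≡ m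
    lenP = trans (length-map (marker 0) ts) (suc-injective len)
    b? = headᵐ (drop m R)
    z = headᵐ (drop (suc m) (drop m R))
    H = peaks (P ++ nothing ∷ R)

  descents-markers : ∀ t → descents (map (marker (+ 0)) t) ≡ 0
  descents-markers = windowSum-map-zero _ (marker (+ 0)) vanish
    where
    vanish : ∀ c l → descent (marker (+ 0) c) (headᵐ (map (marker (+ 0)) l)) ≡ 0
    vanish false l           = refl
    vanish true  []          = refl
    vanish true  (false ∷ l) = refl
    vanish true  (true  ∷ l) = descent-0-pos 0

  ∣next-signed∣ : ∀ ε v → Maybe.map ∣_∣ (headᵐ (drop m (map just (signed ε v))))
                          ≡ headᵐ (drop m (map just v))
  ∣next-signed∣ ε v rewrite drop-map {f = just} m (signed ε v) | drop-map {f = just} m v | drop-signed m ε v =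
    ∣head-signed∣ (drop m ε) (drop m v)

  initialWindow : List Bool
  initialWindow = replicate m false ++ true ∷ []

  length-initialWindow : length initialWindow ≡ suc m
  length-initialWindow = trans (length-++ (replicate m false)) (trans (cong (_+ 1) (length-replicate m)) (+-comm m 1))

  frame-initialWindow : (z : A) (v : List A) → frame z initialWindow v ≡ replicate m nothing ++ map just (z ∷ v)
  frame-initialWindow z v = begin
    map (marker z) (replicate m false ++ true ∷ []) ++ map just v
      ≡⟨ cong (_++ map just v) (map-++ (marker z) (replicate m false) (true ∷ [])) ⟩
    (map (marker z) (replicate m false) ++ just z ∷ []) ++ map just v
      ≡⟨ cong (λ l → (l ++ just z ∷ []) ++ map just v) (map-replicate (marker z) m false) ⟩
    (replicate m nothing ++ just z ∷ []) ++ map just v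
      ≡⟨ ++-assoc (replicate m nothing) (just z ∷ []) (map just v) ⟩
    replicate m nothing ++ map just (z ∷ v) ∎
    where open ≡-Reasoning

  desB≡descents-initialWindow : ∀ π → desB (suc m) π ≡ descents (frame (+ 0) initialWindow π)
  desB≡descents-initialWindow π = begin
    desB (suc m) π                                        ≡⟨ desB≡descents π ⟩
    descents (map just (+ 0 ∷ π))                         ≡⟨ sym (windowSum-replicate nothing (λ _ → refl) m _) ⟩
    descents (replicate m nothing ++ map just (+ 0 ∷ π))  ≡⟨ cong descents (sym (frame-initialWindow (+ 0) π)) ⟩
    descents (frame (+ 0) initialWindow π)                ∎
    where open ≡-Reasoning

  lpeak≡peaks-initialWindow : ∀ σ → lpeak (suc m) σ ≡ peaks (frame 0 initialWindow σ)
  lpeak≡peaks-initialWindow σ = begin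
    lpeak (suc m) σ                                   ≡⟨ lpeak≡peaks σ ⟩
    peaks (map just (0 ∷ σ))                          ≡⟨ sym (windowSum-replicate nothing (λ _ → refl) m _) ⟩
    peaks (replicate m nothing ++ map just (0 ∷ σ))   ≡⟨ cong peaks (sym (frame-initialWindow 0 σ)) ⟩
    peaks (frame 0 initialWindow σ)                   ∎
    where open ≡-Reasoning

  falses-initialWindow : falses initialWindow ≡ m
  falses-initialWindow = trans (falses-++ (replicate m false) (true ∷ [])) (trans (+-identityʳ _) (falses-replicate m))

  module _ (σ : List ℕ) (distinct : AllPairs _≢_ σ) where

    expₓ-initialWindow : ∑ (run initialWindow σ) expₓ ≡ lpeak (suc m) σ
    expₓ-initialWindow =
      trans (peaks-run initialWindow σ length-initialWindow distinct) (sym (lpeak≡peaks-initialWindow σ))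

    exp₂-initialWindow : suc m ≤ length σ → ∑ (run initialWindow σ) exp₂ ≡ 2 * lpeak (suc m) σ + m
    exp₂-initialWindow k≤n = begin
      ∑ (run initialWindow σ) exp₂
        ≡⟨ exp₂-run initialWindow σ length-initialWindow ⟩
      2 * ∑ (run initialWindow σ) expₓ + falses (take (length σ) initialWindow)
        ≡⟨ cong₂ (λ p bs → 2 * p + falses bs) expₓ-initialWindow
                 (take-all (length σ) initialWindow (≤-trans (≤-reflexive length-initialWindow) k≤n)) ⟩
      2 * lpeak (suc m) σ + falses initialWindow
        ≡⟨ cong (_+_ (2 * lpeak (suc m) σ)) falses-initialWindow ⟩
      2 * lpeak (suc m) σ + m ∎
      where open ≡-Reasoning

    exp₂+exp₁₊ₓ-initialWindow :
      ∑ (run initialWindow σ) exp₂ + ∑ (run initialWindow σ) exp₁₊ₓ ≡ length σ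
    exp₂+exp₁₊ₓ-initialWindow = exp₂+exp₁₊ₓ-run initialWindow σ length-initialWindow

    exp₁₊ₓ-initialWindow : suc m ≤ length σ →
                           ∑ (run initialWindow σ) exp₁₊ₓ ≡ length σ ∸ suc m + 1 ∸ 2 * lpeak (suc m) σ
    exp₁₊ₓ-initialWindow k≤n = begin
      b                                  ≡⟨ sym (m+n∸m≡n a b) ⟩
      a + b ∸ a                          ≡⟨ cong₂ _∸_ exp₂+exp₁₊ₓ-initialWindow
                                                      (trans (exp₂-initialWindow k≤n) (+-comm (2 * p) m)) ⟩
      length σ ∸ (m + 2 * p)             ≡⟨ sym (∸-+-assoc (length σ) m (2 * p)) ⟩
      length σ ∸ m ∸ 2 * p               ≡⟨ cong (_∸ 2 * p) (sym (∸-suc-+1 k≤n)) ⟩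
      length σ ∸ suc m + 1 ∸ 2 * p       ∎
      where
      open ≡-Reasoning
      a = ∑ (run initialWindow σ) exp₂
      b = ∑ (run initialWindow σ) exp₁₊ₓ
      p = lpeak (suc m) σ

    lpeak-bound : suc m ≤ length σ → lpeak (suc m) σ < suc ((length σ ∸ suc m + 1) / 2)
    lpeak-bound k≤n = s≤s (begin
      p                                  ≡⟨ sym (m*n/n≡m p 2) ⟩
      p * 2 / 2                          ≤⟨ /-monoˡ-≤ 2 (≤-trans (≤-reflexive (*-comm p 2)) 2p≤) ⟩
      (length σ ∸ suc m + 1) / 2         ∎)
      where
      open ≤-Reasoning
      p = lpeak (suc m) σ
      2p≤ : 2 * p ≤ length σ ∸ suc m + 1
      2p≤ = begin
        2 * p                ≤⟨ m+n≤o⇒m≤o∸n (2 * p) (m+n≤o⇒m≤o (2 * p + m) (≤-reflexive 2p+m+b≡n)) ⟩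
        length σ ∸ m         ≡⟨ sym (∸-suc-+1 k≤n) ⟩
        length σ ∸ suc m + 1 ∎
        where
        2p+m+b≡n : 2 * p + m + ∑ (run initialWindow σ) exp₁₊ₓ ≡ length σ
        2p+m+b≡n = trans (cong (_+ ∑ (run initialWindow σ) exp₁₊ₓ) (sym (exp₂-initialWindow k≤n)))
                         exp₂+exp₁₊ₓ-initialWindow

module SignSums (m x : ℕ) where
  open Window m

  monomial : ℕ → ℕ → ℕ → ℕ
  monomial i j l = 2 ^ i * x ^ j * (1 + x) ^ l

  weight : Step → ℕ
  weight s = monomial (exp₂ s) (expₓ s) (exp₁₊ₓ s)

  runWeight : List Step → ℕ
  runWeight r = monomial (∑ r exp₂) (∑ r expₓ) (∑ r exp₁₊ₓ)

  monomial-* : ∀ i j l i′ j′ l′ →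
               monomial i j l * monomial i′ j′ l′ ≡ monomial (i + i′) (j + j′) (l + l′)
  monomial-* i j l i′ j′ l′ = begin
    (2 ^ i * x ^ j * (1 + x) ^ l) * (2 ^ i′ * x ^ j′ * (1 + x) ^ l′)
      ≡⟨ regroup (2 ^ i) (x ^ j) ((1 + x) ^ l) (2 ^ i′) (x ^ j′) ((1 + x) ^ l′) ⟩
    (2 ^ i * 2 ^ i′) * (x ^ j * x ^ j′) * ((1 + x) ^ l * (1 + x) ^ l′)
      ≡⟨ sym (cong₂ _*_ (cong₂ _*_ (^-distribˡ-+-* 2 i i′) (^-distribˡ-+-* x j j′))
                        (^-distribˡ-+-* (1 + x) l l′)) ⟩
    monomial (i + i′) (j + j′) (l + l′) ∎
    where
    open ≡-Reasoning
    regroup : ∀ a b c d e f → (a * b * c) * (d * e * f) ≡ (a * d) * (b * e) * (c * f)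
    regroup = solve-∀

  -- The sign of the successor y need not be summed yet: if ∣y∣ < a then +a lies above y and -a below
  -- it, and if ∣y∣ > a both ±a compare with y as 0 does.
  descent-step : ∀ t {a s b?} (y : Maybe ℤ) → Follows (suc a) s b? → Maybe.map ∣_∣ y ≡ b? →
                 x ^ (descent (marker (+ 0) t) (just (+ suc a)) + descent (just (+ suc a)) y)
                 + x ^ (descent (marker (+ 0) t) (just -[1+ a ]) + descent (just -[1+ a ]) y)
                 ≡ weight (t , s) * x ^ descent (marker (+ 0) (ascends s)) y
  descent-step false      nothing  last       refl = refl
  descent-step true  {a}  nothing  last       refl
    rewrite descent-0-pos (suc a) | descent-0-neg a = identity x
    where
    identity : ∀ y → 1 + y * 1 ≡ 1 * 1 * ((1 + y) * 1) * 1
    identity = solve-∀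
  descent-step false      (just z) (down z<a) refl
    rewrite proj₁ (descent-below z z<a) | proj₂ (descent-below z z<a) = identity x
    where
    identity : ∀ y → y * 1 + 1 ≡ 1 * 1 * ((1 + y) * 1) * 1
    identity = solve-∀
  descent-step true  {a}  (just z) (down z<a) refl
    rewrite descent-0-pos (suc a) | descent-0-neg a | proj₁ (descent-below z z<a) | proj₂ (descent-below z z<a) =
    identity x
    where
    identity : ∀ y → y * 1 + y * 1 ≡ 2 * 1 * (y * 1) * 1 * 1
    identity = solve-∀
  descent-step false      (just z) (up a<z)   refl
    rewrite proj₁ (descent-above z a<z) | proj₂ (descent-above z a<z) = identity (x ^ descent (just (+ 0)) (just z))
    where
    identity : ∀ u → u + u ≡ 2 * 1 * 1 * 1 * u
    identity = solve-∀
  descent-step true  {a}  (just z) (up a<z)   refl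
    rewrite descent-0-pos (suc a) | descent-0-neg a | proj₁ (descent-above z a<z) | proj₂ (descent-above z a<z) =
    identity x (x ^ descent (just (+ 0)) (just z))
    where
    identity : ∀ y u → u + y * u ≡ 1 * 1 * ((1 + y) * 1) * u
    identity = solve-∀

  signSum : List Bool → List ℕ → ℕ
  signSum t v = ∑[ ε ← words (length v) bools ] x ^ descents (frame (+ 0) t (signed ε v))

  ∑-first-sign : ∀ t ts a v ε → length ts ≡ m → All (suc a ≢_) v →
               ∑[ e ← bools ] x ^ descents (frame (+ 0) (t ∷ ts) (signed (e ∷ ε) (suc a ∷ v)))
               ≡ weight (t , link (suc a) (drop m v))
                 * x ^ descents (frame (+ 0) (ts ∷ʳ ascends (link (suc a) (drop m v))) (signed ε v))
  ∑-first-sign t ts a v ε len a∉v = begin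
    x ^ descents (c₀ ∷ P ++ just (+ suc a) ∷ R) + (x ^ descents (c₀ ∷ P ++ just -[1+ a ] ∷ R) + 0)
      ≡⟨ cong₂ (λ i j → x ^ i + j) (slide (just (+ suc a)))
                                     (trans (+-identityʳ _) (cong (x ^_) (slide (just -[1+ a ])))) ⟩
    x ^ (D⁺ + G) + x ^ (D⁻ + G)
      ≡⟨ cong₂ _+_ (^-distribˡ-+-* x D⁺ G) (^-distribˡ-+-* x D⁻ G) ⟩
    x ^ D⁺ * x ^ G + x ^ D⁻ * x ^ G
      ≡⟨ sym (*-distribʳ-+ (x ^ G) (x ^ D⁺) (x ^ D⁻)) ⟩
    (x ^ D⁺ + x ^ D⁻) * x ^ G
      ≡⟨ cong (_* x ^ G) (descent-step t y (follows-next (suc a) v a∉v) (∣next-signed∣ ε v)) ⟩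
    weight (t , s) * x ^ d′ * x ^ G
      ≡⟨ *-assoc (weight (t , s)) (x ^ d′) (x ^ G) ⟩
    weight (t , s) * (x ^ d′ * x ^ G)
      ≡⟨ cong (weight (t , s) *_) (sym (^-distribˡ-+-* x d′ G)) ⟩
    weight (t , s) * x ^ (d′ + G)
      ≡⟨ cong (λ i → weight (t , s) * x ^ i)
              (sym (windowSum-replace nothing (λ _ → refl) P (≤-reflexive lenP))) ⟩
    weight (t , s) * x ^ descents (P ++ marker (+ 0) (ascends s) ∷ R)
      ≡⟨ cong (λ l → weight (t , s) * x ^ descents l) (sym (frame-∷ʳ (+ 0) ts (ascends s) (signed ε v))) ⟩
    weight (t , s) * x ^ descents (frame (+ 0) (ts ∷ʳ ascends s) (signed ε v)) ∎
    where
    open ≡-Reasoning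
    s = link (suc a) (drop m v)
    c₀ = marker (+ 0) t
    P = map (marker (+ 0)) ts
    R = map just (signed ε v)
    lenP : length P ≡ m
    lenP = trans (length-map (marker (+ 0)) ts) len
    y = headᵐ (drop m R)
    G = descents (P ++ nothing ∷ R)
    D⁺ = descent c₀ (just (+ suc a)) + descent (just (+ suc a)) y
    D⁻ = descent c₀ (just -[1+ a ]) + descent (just -[1+ a ]) y
    d′ = descent (marker (+ 0) (ascends s)) y
    slide : ∀ c → descents (c₀ ∷ P ++ c ∷ R) ≡ (descent c₀ c + descent c y) + G
    slide c = windowSum-slide nothing (λ _ → refl) c₀ P lenP

  signSum-run : ∀ t v → length t ≡ suc m → All (1 ≤_) v → AllPairs _≢_ v →
                signSum t v ≡ runWeight (run t v)
  signSum-run (t ∷ ts) []          _   _                 _ =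
    trans (cong (λ l → x ^ descents l + 0) (++-identityʳ (map (marker (+ 0)) (t ∷ ts))))
          (cong (λ d → x ^ d + 0) (descents-markers (t ∷ ts)))
  signSum-run (t ∷ ts) (zero ∷ v)  _   (() ∷ _)          _
  signSum-run (t ∷ ts) (suc a ∷ v) len (_ ∷ positive) (a∉v ∷ distinct) = begin
    ∑[ ε ← words (suc (length v)) bools ] x ^ descents (frame (+ 0) (t ∷ ts) (signed ε (suc a ∷ v)))
      ≡⟨ ∑-words-suc (length v) bools _ ⟩
    ∑[ e ← bools ] ∑[ ε ← W ] x ^ descents (frame (+ 0) (t ∷ ts) (signed (e ∷ ε) (suc a ∷ v)))
      ≡⟨ ∑-comm bools W (λ e ε → x ^ descents (frame (+ 0) (t ∷ ts) (signed (e ∷ ε) (suc a ∷ v)))) ⟩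
    ∑[ ε ← W ] ∑[ e ← bools ] x ^ descents (frame (+ 0) (t ∷ ts) (signed (e ∷ ε) (suc a ∷ v)))
      ≡⟨ ∑-cong W (λ ε → ∑-first-sign t ts a v ε len′ a∉v) ⟩
    ∑[ ε ← W ] weight (t , s) * x ^ descents (frame (+ 0) ts′ (signed ε v))
      ≡⟨ ∑-*ˡ (weight (t , s)) W _ ⟩
    weight (t , s) * signSum ts′ v
      ≡⟨ cong (weight (t , s) *_) (signSum-run ts′ v (length-∷ʳ ts (ascends s) len′) positive distinct) ⟩
    weight (t , s) * runWeight (run ts′ v)
      ≡⟨ monomial-* (exp₂ (t , s)) (expₓ (t , s)) (exp₁₊ₓ (t , s)) _ _ _ ⟩
    runWeight (run (t ∷ ts) (suc a ∷ v)) ∎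
    where
    open ≡-Reasoning
    len′ = suc-injective len
    s = link (suc a) (drop m v)
    ts′ = ts ∷ʳ ascends s
    W = words (length v) bools

  monomial-cong : ∀ {i j l i′ j′ l′} → i ≡ i′ → j ≡ j′ → l ≡ l′ →
                  monomial i j l ≡ monomial i′ j′ l′
  monomial-cong refl refl refl = refl

  summand : ℕ → ℕ → ℕ
  summand n p = 2 ^ (2 * p + suc m ∸ 1) * x ^ p * (1 + x) ^ (n ∸ suc m + 1 ∸ 2 * p)

  signSum-Sn : ∀ {n σ} → suc m ≤ n → σ ∈ Sn n →
               ∑[ ε ← words n bools ] x ^ desB (suc m) (signed ε σ) ≡ summand n (lpeak (suc m) σ)
  signSum-Sn {n} {σ} k≤n σ∈Sn with ∈-Sn⁻ n σ∈Sn
  ... | refl , positive , distinct = begin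
    ∑[ ε ← words (length σ) bools ] x ^ desB (suc m) (signed ε σ)
      ≡⟨ ∑-cong (words (length σ) bools) (λ ε → cong (x ^_) (desB≡descents-initialWindow (signed ε σ))) ⟩
    signSum initialWindow σ
      ≡⟨ signSum-run initialWindow σ length-initialWindow positive distinct ⟩
    runWeight (run initialWindow σ)
      ≡⟨ monomial-cong (trans (exp₂-initialWindow σ distinct k≤n) (cong (_∸ 1) (sym (+-suc (2 * p) m))))
                       (expₓ-initialWindow σ distinct) (exp₁₊ₓ-initialWindow σ distinct k≤n) ⟩
    summand (length σ) p ∎
    where
    open ≡-Reasoning
    p = lpeak (suc m) σ

  lpeak-bound-Sn : ∀ {n σ} → suc m ≤ n → σ ∈ Sn n → lpeak (suc m) σ < suc ((n ∸ suc m + 1) / 2)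
  lpeak-bound-Sn {n} k≤n σ∈Sn with ∈-Sn⁻ n σ∈Sn
  ... | refl , _ , distinct = lpeak-bound _ distinct k≤n

theorem17 : (n k : ℕ) → 1 ≤ k → k ≤ n → (x : ℕ) → WB n k x ≡ gammaExpansion n k x
theorem17 n (suc m) _ k≤n x = begin
  WB n (suc m) x
    ≡⟨ ∑-Bn n (λ π → x ^ desB (suc m) π) ⟩
  ∑[ σ ← Sn n ] ∑[ ε ← words n bools ] x ^ desB (suc m) (signed ε σ)
    ≡⟨ ∑-cong-∈ (Sn n) (signSum-Sn k≤n) ⟩
  ∑[ σ ← Sn n ] summand n (lpeak (suc m) σ)
    ≡⟨ ∑-fibres (lpeak (suc m)) (summand n) N (Sn n) (All.tabulate (lpeak-bound-Sn k≤n)) ⟩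
  ∑[ p ← upTo N ] (Gamma n (suc m) p * summand n p)
    ≡⟨ ∑-cong (upTo N) (λ p → regroup (Gamma n (suc m) p) (2 ^ (2 * p + suc m ∸ 1)) (x ^ p) _) ⟩
  gammaExpansion n (suc m) x ∎
  where
  open ≡-Reasoning
  open SignSums m x
  N = suc ((n ∸ suc m + 1) / 2)
  regroup : ∀ γ a b c → γ * (a * b * c) ≡ a * γ * b * c
  regroup = solve-∀
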